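{- Consider the algorithm MatchingAlgorithm described in the context, run with parameter $q$ satisfying $8\sqrt{\Delta}\le q\le\Delta/4$. Fix a vertex $v$ and let $e_{t_1}=(u_1,v),\dots,e_{t_\ell}=(u_\ell,v)$ be the edges incident to $v$, arriving at times $t_1<\dots<t_\ell$. Let $S:=\{u_i : u_i \text{ is not covered by } M_{t_i}\}$. Then $$F(v)\ \ge\ 1-\sum_{u_i\in S}\frac{1}{\Delta+q}\cdot\frac{1}{F_{t_i}(u_i)}.$$ Consequently, $F(v)\ge q/(3\Delta)$ holds if $$\sum_{u_i\in S}\frac{1}{\Delta+q}\cdot\frac{1}{F_{t_i}(u_i)}\le\frac{\Delta}{\Delta+q/2}.$$
   Context: Let $G=(V,E)$ be a simple undirected graph with maximum degree at most $\Delta$, whose edges $e_1,\dots,e_m$ are revealed one at a time in an order fixed in advance. Let $q>0$ be a parameter. MatchingAlgorithm: initially $F_1(w)=1$ for all vertices $w$ and $M_1=\emptyset$. At time $t=1,\dots,m$, with $e_t=(u,v)$: sample $X_t\sim\mathrm{Uniform}[0,1]$ independently; define $P(e_t)=\frac{1}{\Delta+q}\cdot\frac{1}{F_t(u)F_t(v)}$ if neither $u$ nor $v$ is covered by $M_t$, and $P(e_t)=0$ otherwise; define $\hat P(e_t)=P(e_t)$ if $\min\{F_t(u),F_t(v)\}\cdot(1-P(e_t))\ge q/(4\Delta)$, and $\hat P(e_t)=0$ otherwise; set $F_{t+1}(u)=F_t(u)(1-\hat P(e_t))$, $F_{t+1}(v)=F_t(v)(1-\hat P(e_t))$, $F_{t+1}(w)=F_t(w)$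 for $w\notin\{u,v\}$; set $M_{t+1}=M_t\cup\{e_t\}$ if $X_t<\hat P(e_t)$, else $M_{t+1}=M_t$. $F(v)$ denotes the final value $F_{m+1}(v)$ after all edges have been processed; $M_{t_i}$ is the matching just before edge $e_{t_i}$ is processed.
   Formalization: The parameter $q$ is rational, and the samples $X_t$ range over the rationals in $[0,1]$. -}

module Defs where

open import Data.Nat as ℕ using (ℕ; zero; suc)
open import Data.Integer using (+_)
open import Data.Rational using (ℚ; 0ℚ; 1ℚ; _+_; _*_; _-_; _⊓_; _≤_; _<_; 1/_; ≢-nonZero) renaming (_/_ to _//_)
open import Data.Rational.Properties using (_≟_; _≤?_; _<?_)
import Data.Fin
open import Data.Fin using (Fin)
open import Data.Fin.Properties as FinP using ()
open import Data.List using (List; []; _∷_; length; lookup; take; zip)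
open import Data.List.Relation.Unary.Any using (Any; any?)
open import Data.Product using (_×_; _,_; proj₁; proj₂)
open import Data.Sum using (_⊎_)
open import Data.Maybe using (Maybe; just; nothing)
open import Data.Bool using (Bool; true; false; if_then_else_; _∨_)
open import Relation.Nullary using (Dec; yes; no; ¬_; does)
open import Relation.Nullary.Decidable using (_⊎-dec_)
open import Relation.Binary.PropositionalEquality using (_≡_; _≢_)

Edge : ℕ → Set
Edge n = Fin n × Fin n

ℕtoℚ : ℕ → ℚ
ℕtoℚ k = (+ k) // 1

-- total reciprocal: 1/x for x ≠ 0, and 0 at 0 (only ever applied to positive values)
inv : ℚ → ℚ
inv x with x ≟ 0ℚ
... | yes _ = 0ℚ
... | no x≢0 = 1/_ x {{≢-nonZero x≢0}}

Touches : ∀ {n} → Fin n → Edge n → Set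
Touches w e = (proj₁ e ≡ w) ⊎ (proj₂ e ≡ w)

touches? : ∀ {n} → Fin n → Edge n → Bool
touches? w e = does (proj₁ e FinP.≟ w) ∨ does (proj₂ e FinP.≟ w)

degree : ∀ {n} → List (Edge n) → Fin n → ℕ
degree [] w = 0
degree (e ∷ es) w = if touches? w e then suc (degree es w) else degree es w

SameEdge : ∀ {n} → Edge n → Edge n → Set
SameEdge (a , b) (c , d) = ((a ≡ c) × (b ≡ d)) ⊎ ((a ≡ d) × (b ≡ c))

Simple : ∀ {n} → List (Edge n) → Set
Simple es =
  ((i : Fin (length es)) → proj₁ (lookup es i) ≢ proj₂ (lookup es i)) ×
  ((i j : Fin (length es)) → SameEdge (lookup es i) (lookup es j) → i ≡ j)

MaxDegreeAtMost : ∀ {n} → List (Edge n) → ℕ → Set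
MaxDegreeAtMost {n} es Δ = (w : Fin n) → degree es w ℕ.≤ Δ

record State (n : ℕ) : Set where
  constructor ⟨_,_⟩
  field
    F : Fin n → ℚ
    M : List (Edge n)
open State public

Covered : ∀ {n} → List (Edge n) → Fin n → Set
Covered M w = Any (Touches w) M

touchesDec : ∀ {n} (w : Fin n) (e : Edge n) → Dec (Touches w e)
touchesDec w e = (proj₁ e FinP.≟ w) ⊎-dec (proj₂ e FinP.≟ w)

covered? : ∀ {n} (M : List (Edge n)) (w : Fin n) → Dec (Covered M w)
covered? M w = any? (touchesDec w) M

initState : ∀ {n} → State n
initState = ⟨ (λ _ → 1ℚ) , [] ⟩

module Algorithm (Δ : ℕ) (q : ℚ) where

  c : ℚ
  c = inv (ℕtoℚ Δ + q)

  Pval : ∀ {n} → State n → Edge n → ℚ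
  Pval s (u , v) with covered? (M s) u | covered? (M s) v
  ... | no _ | no _ = c * inv (F s u * F s v)
  ... | _    | _    = 0ℚ

  thr : ℚ
  thr = q * inv (ℕtoℚ (4 ℕ.* Δ))

  Phat : ∀ {n} → State n → Edge n → ℚ
  Phat s (u , v) with thr ≤? ((F s u ⊓ F s v) * (1ℚ - Pval s (u , v)))
  ... | yes _ = Pval s (u , v)
  ... | no _  = 0ℚ

  step : ∀ {n} → State n → Edge n × ℚ → State n
  step {n} s ((u , v) , x) = ⟨ F′ , M′ ⟩
    where
    p : ℚ
    p = Phat s (u , v)
    F′ : Fin n → ℚ
    F′ w = if touches? w (u , v) then F s w * (1ℚ - p) else F s w
    M′ : List (Edge n)
    M′ with x <? p
    ... | yes _ = (u , v) ∷ M s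
    ... | no _  = M s

  run : ∀ {n} → State n → List (Edge n × ℚ) → State n
  run s [] = s
  run s (ex ∷ exs) = run (step s ex) exs

  -- the state (F_{t+1}, M_{t+1}) just before edge number t (0-indexed) is processed,
  -- i.e. after the first t edges; X t is the sample X_{t+1} used for edge number t.
  stateBefore : ∀ {n} → List (Edge n) → (ℕ → ℚ) → ℕ → State n
  stateBefore es X t = run initState (take t (zip es (samples 0 es)))
    where
    samples : ∀ {n} → ℕ → List (Edge n) → List ℚ
    samples k [] = []
    samples k (_ ∷ r) = X k ∷ samples (suc k) r

  finalF : ∀ {n} → List (Edge n) → (ℕ → ℚ) → Fin n → ℚ
  finalF es X = F (stateBefore es X (length es))

  other : ∀ {n} → Fin n → Edge n → Maybe (Fin n)
  other v (a , b) with a FinP.≟ v | b FinP.≟ v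
  ... | yes _ | _     = just b
  ... | no _  | yes _ = just a
  ... | no _  | no _  = nothing

  term : ∀ {n} → (es : List (Edge n)) → (ℕ → ℚ) → Fin n → (t : Fin (length es)) → ℚ
  term es X v t with other v (lookup es t)
  ... | nothing = 0ℚ
  ... | just u with covered? (M (stateBefore es X (Data.Fin.toℕ t))) u
  ...   | yes _ = 0ℚ
  ...   | no _  = c * inv (F (stateBefore es X (Data.Fin.toℕ t)) u)

  sumS : ∀ {n} → List (Edge n) → (ℕ → ℚ) → Fin n → ℚ
  sumS es X v = go (length es) (λ t → term es X v t)
    where
    go : (k : ℕ) → (Fin k → ℚ) → ℚ
    go zero f = 0ℚ
    go (suc k) f = f Data.Fin.zero + go k (λ i → f (Data.Fin.suc i))

{-# OPTIONS --safe #-}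

-- All F_t stay positive: a nonzero P̂ requires min F · (1 − P) ≥ q/(4Δ) > 0.
-- If e_t = (u, v) is sampled with probability P̂ = P ≠ 0, then both ends are free and
-- F_{t+1}(v) = F_t(v) (1 − c / (F_t(u) F_t(v))) = F_t(v) − c / F_t(u) with c = 1/(Δ+q),
-- which is exactly the summand of u; in every other case F(v) does not change and
-- the summand is nonnegative.  Telescoping over t gives F(v) ≥ 1 − Σ.
-- The second claim is then the arithmetic q/(3Δ) ≤ (q/2)/(Δ + q/2) = 1 − Δ/(Δ + q/2),
-- which amounts to q ≤ Δ.

module Submission where

open import Defs
open import Data.Nat as ℕ using (ℕ; zero; suc; NonZero)
open import Data.Rational
  using (ℚ; 0ℚ; 1ℚ; _+_; _*_; _-_; -_; _≤_; _<_; _⊓_; ≢-nonZero; positive; nonNegative; +-0-rawMonoid)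
open import Data.Rational.Properties
open import Data.Rational.Solver using (module +-*-Solver)
open import Data.Fin using (Fin; toℕ)
import Data.Fin.Properties as Finₚ
open import Data.List using (List; []; _∷_; length; lookup; take; zip)
open import Data.Maybe using (just; nothing)
open import Data.Product using (_×_; _,_)
open import Data.Sum using (_⊎_; inj₁; inj₂; [_,_]′)
open import Data.Bool using (true; false; if_then_else_)
open import Function using (_∘_)
open import Relation.Nullary using (yes; no; contradiction)
open import Relation.Binary.PropositionalEquality
open import Algebra.Definitions.RawMonoid +-0-rawMonoid using (sum)
open +-*-Solver

*-pos : ∀ {a b} → 0ℚ < a → 0ℚ < b → 0ℚ < a * b
*-pos {a} {b} 0<a 0<b = positive⁻¹ (a * b) {{pos*pos⇒pos a {{positive 0<a}} b {{positive 0<b}}}}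

*-nonNeg : ∀ {a b} → 0ℚ ≤ a → 0ℚ ≤ b → 0ℚ ≤ a * b
*-nonNeg {a} {b} 0≤a 0≤b =
  nonNegative⁻¹ (a * b) {{nonNeg*nonNeg⇒nonNeg a {{nonNegative 0≤a}} b {{nonNegative 0≤b}}}}

*-cancelˡ-pos : ∀ {a b} → 0ℚ < a → 0ℚ < a * b → 0ℚ < b
*-cancelˡ-pos {a} {b} 0<a 0<ab =
  *-cancelˡ-<-nonNeg a {{nonNegative (<⇒≤ 0<a)}} (subst (_< a * b) (sym (*-zeroʳ a)) 0<ab)

⊓-pos : ∀ {a b} → 0ℚ < a → 0ℚ < b → 0ℚ < a ⊓ b
⊓-pos {a} {b} 0<a 0<b with ⊓-sel a b
... | inj₁ a⊓b≡a = subst (0ℚ <_) (sym a⊓b≡a) 0<a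
... | inj₂ a⊓b≡b = subst (0ℚ <_) (sym a⊓b≡b) 0<b

x-y≤x : ∀ {x y} → 0ℚ ≤ y → x - y ≤ x
x-y≤x {x} 0≤y = ≤-trans (+-monoʳ-≤ x (neg-antimono-≤ 0≤y)) (≤-reflexive (+-identityʳ x))

x-y≤x*[1-p] : ∀ {x y p} → x * p ≤ y → x - y ≤ x * (1ℚ - p)
x-y≤x*[1-p] {x} {y} {p} xp≤y = ≤-trans (+-monoʳ-≤ x (neg-antimono-≤ xp≤y))
  (≤-reflexive (solve 2 (λ x p → x :- x :* p := x :* (con 1ℚ :- p)) refl x p))

x≤k*x : ∀ {x k} → 0ℚ ≤ x → 1ℚ ≤ k → x ≤ k * x
x≤k*x {x} 0≤x 1≤k =
  ≤-trans (≤-reflexive (sym (*-identityˡ x))) (*-monoʳ-≤-nonNeg x {{nonNegative 0≤x}} 1≤k)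

ℕtoℚ-pos : ∀ k .{{_ : NonZero k}} → 0ℚ < ℕtoℚ k
ℕtoℚ-pos k = positive⁻¹ (ℕtoℚ k) {{normalize-pos k 1}}

inv-pos : ∀ {x} → 0ℚ < x → 0ℚ < inv x
inv-pos {x} 0<x with x ≟ 0ℚ
... | yes x≡0 = contradiction (sym x≡0) (<⇒≢ 0<x)
... | no x≢0 = positive⁻¹ _ {{1/pos⇒pos x {{positive 0<x}}}}

*-inv≡1 : ∀ {x} → 0ℚ < x → x * inv x ≡ 1ℚ
*-inv≡1 {x} 0<x with x ≟ 0ℚ
... | yes x≡0 = contradiction (sym x≡0) (<⇒≢ 0<x)
... | no x≢0 = *-inverseʳ x {{≢-nonZero x≢0}}

x*inv[x*y]≡inv[y] : ∀ {x y} → 0ℚ < x → 0ℚ < y → x * inv (x * y) ≡ inv y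
x*inv[x*y]≡inv[y] {x} {y} 0<x 0<y = begin
  x * i            ≡⟨ sym (*-identityʳ (x * i)) ⟩
  x * i * 1ℚ       ≡⟨ cong (x * i *_) (sym (*-inv≡1 0<y)) ⟩
  x * i * (y * j)  ≡⟨ solve 4 (λ x y i j → x :* i :* (y :* j) := x :* y :* i :* j) refl x y i j ⟩
  x * y * i * j    ≡⟨ cong (_* j) (*-inv≡1 (*-pos 0<x 0<y)) ⟩
  1ℚ * j           ≡⟨ *-identityˡ j ⟩
  j                ∎
  where
  open ≡-Reasoning
  i = inv (x * y)
  j = inv y

x*[c*inv[x*y]]≡c*inv[y] : ∀ {x y} c → 0ℚ < x → 0ℚ < y → x * (c * inv (x * y)) ≡ c * inv y
x*[c*inv[x*y]]≡c*inv[y] {x} {y} c 0<x 0<y =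
  trans (solve 3 (λ x c i → x :* (c :* i) := c :* (x :* i)) refl x c (inv (x * y)))
        (cong (c *_) (x*inv[x*y]≡inv[y] 0<x 0<y))

a*inv[b]≤c*inv[d] : ∀ {a b c d} → 0ℚ < b → 0ℚ < d → a * d ≤ c * b → a * inv b ≤ c * inv d
a*inv[b]≤c*inv[d] {a} {b} {c} {d} 0<b 0<d ad≤cb = begin
  a * i                 ≡⟨ cancel a d i (*-inv≡1 0<d) ⟩
  a * d * (i * j)       ≤⟨ *-monoʳ-≤-nonNeg (i * j) {{nonNegative 0≤ij}} ad≤cb ⟩
  c * b * (i * j)       ≡⟨ cong (c * b *_) (*-comm i j) ⟩
  c * b * (j * i)       ≡⟨ sym (cancel c b j (*-inv≡1 0<b)) ⟩
  c * j                 ∎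
  where
  open ≤-Reasoning
  i = inv b
  j = inv d
  0≤ij : 0ℚ ≤ i * j
  0≤ij = <⇒≤ (*-pos (inv-pos 0<b) (inv-pos 0<d))
  cancel : ∀ x y z → y * inv y ≡ 1ℚ → x * z ≡ x * y * (z * inv y)
  cancel x y z y*inv[y]≡1 = begin-equality
    x * z                 ≡⟨ sym (*-identityʳ (x * z)) ⟩
    x * z * 1ℚ            ≡⟨ cong (x * z *_) (sym y*inv[y]≡1) ⟩
    x * z * (y * inv y)   ≡⟨ solve 4 (λ x y z k → x :* z :* (y :* k) := x :* y :* (z :* k)) refl x y z (inv y) ⟩
    x * y * (z * inv y)   ∎

1-x*inv[x+y]≡y*inv[x+y] : ∀ {x y} → 0ℚ < x + y → 1ℚ - x * inv (x + y) ≡ y * inv (x + y)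
1-x*inv[x+y]≡y*inv[x+y] {x} {y} 0<x+y = begin
  1ℚ - x * k               ≡⟨ cong (_- x * k) (sym (*-inv≡1 0<x+y)) ⟩
  (x + y) * k - x * k      ≡⟨ solve 3 (λ x y k → (x :+ y) :* k :- x :* k := y :* k) refl x y k ⟩
  y * k                    ∎
  where
  open ≡-Reasoning
  k = inv (x + y)

q*inv[3D]≤1-D*inv[D+q/2] : ∀ {q D} → 0ℚ < q → q ≤ D →
  q * inv (ℕtoℚ 3 * D) ≤ 1ℚ - D * inv (D + q * inv (ℕtoℚ 2))
q*inv[3D]≤1-D*inv[D+q/2] {q} {D} 0<q q≤D = begin
  q * inv (ℕtoℚ 3 * D)  ≤⟨ a*inv[b]≤c*inv[d] {q} {c = h} (*-pos (ℕtoℚ-pos 3) 0<D) 0<D+h cross ⟩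
  h * inv (D + h)       ≡⟨ sym (1-x*inv[x+y]≡y*inv[x+y] {D} 0<D+h) ⟩
  1ℚ - D * inv (D + h)  ∎
  where
  open ≤-Reasoning
  h = q * inv (ℕtoℚ 2)
  0<h : 0ℚ < h
  0<h = *-pos 0<q (inv-pos (ℕtoℚ-pos 2))
  0<D : 0ℚ < D
  0<D = <-≤-trans 0<q q≤D
  0<D+h : 0ℚ < D + h
  0<D+h = +-mono-< 0<D 0<h
  cross : q * (D + h) ≤ h * (ℕtoℚ 3 * D)
  cross = begin
    q * (D + h)                  ≡⟨ solve 2 (λ q D → q :* (D :+ q :* ½)
                                                  := q :* ½ :* (con (ℕtoℚ 2) :* D) :+ q :* ½ :* q) refl q D ⟩
    h * (ℕtoℚ 2 * D) + h * q     ≤⟨ +-monoʳ-≤ (h * (ℕtoℚ 2 * D)) hq≤hD ⟩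
    h * (ℕtoℚ 2 * D) + h * D     ≡⟨ solve 2 (λ h D → h :* (con (ℕtoℚ 2) :* D) :+ h :* D
                                                  := h :* (con (ℕtoℚ 3) :* D)) refl h D ⟩
    h * (ℕtoℚ 3 * D)             ∎
    where
    ½ = con (inv (ℕtoℚ 2))
    hq≤hD : h * q ≤ h * D
    hq≤hD = *-monoˡ-≤-nonNeg h {{nonNegative (<⇒≤ 0<h)}} q≤D

a₀-sum≤aₖ : ∀ {k} (a : ℕ → ℚ) (f : Fin k → ℚ) →
  (∀ i → a (toℕ i) - f i ≤ a (suc (toℕ i))) → a 0 - sum f ≤ a k
a₀-sum≤aₖ {zero} a f _ = ≤-reflexive (+-identityʳ (a 0))
a₀-sum≤aₖ {suc k} a f step = begin
  a 0 - (f Fin.zero + sum (f ∘ Fin.suc))  ≡⟨ solve 3 (λ x y z → x :- (y :+ z) := (x :- y) :- z) refl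
                                                     (a 0) (f Fin.zero) (sum (f ∘ Fin.suc)) ⟩
  (a 0 - f Fin.zero) - sum (f ∘ Fin.suc)  ≤⟨ +-monoˡ-≤ (- sum (f ∘ Fin.suc)) (step Fin.zero) ⟩
  a 1 - sum (f ∘ Fin.suc)                  ≤⟨ a₀-sum≤aₖ (a ∘ suc) (f ∘ Fin.suc) (step ∘ Fin.suc) ⟩
  a (suc k)                                ∎
  where open ≤-Reasoning

sum-unique : (g : (k : ℕ) → (Fin k → ℚ) → ℚ) → (∀ f → g 0 f ≡ 0ℚ) →
  (∀ k f → g (suc k) f ≡ f Fin.zero + g k (f ∘ Fin.suc)) → ∀ k f → g k f ≡ sum f
sum-unique g g0 gs zero f = g0 f
sum-unique g g0 gs (suc k) f = trans (gs k f) (cong (f Fin.zero +_) (sum-unique g g0 gs k (f ∘ Fin.suc)))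

sumS≡sum : ∀ Δ q {n} (es : List (Edge n)) X v → Algorithm.sumS Δ q es X v ≡ sum (Algorithm.term Δ q es X v)
-- sumS sums with a function local to Defs; abstracting its arguments lets
-- unification solve the `_` below with that function.
sumS≡sum Δ q es X v with length es | Algorithm.term Δ q es X v | sum-unique _ (λ _ → refl) (λ _ _ → refl)
... | k | f | go≡sum = go≡sum k f

module Bounds (Δ : ℕ) (q : ℚ) (0≤c : 0ℚ ≤ Algorithm.c Δ q) (0<thr : 0ℚ < Algorithm.thr Δ q)
              {n : ℕ} where
  open Algorithm Δ q

  PositiveF : State n → Set
  PositiveF s = ∀ w → 0ℚ < F s w

  0≤c*inv : ∀ {x} → 0ℚ < x → 0ℚ ≤ c * inv x
  0≤c*inv 0<x = *-nonNeg 0≤c (<⇒≤ (inv-pos 0<x))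

  Phat≡0⊎Phat≡Pval : ∀ (s : State n) e → Phat s e ≡ 0ℚ ⊎ Phat s e ≡ Pval s e
  Phat≡0⊎Phat≡Pval s (u , w) with thr ≤? ((F s u ⊓ F s w) * (1ℚ - Pval s (u , w)))
  ... | yes _ = inj₂ refl
  ... | no _  = inj₁ refl

  0<1-Phat : ∀ {s} → PositiveF s → ∀ e → 0ℚ < 1ℚ - Phat s e
  0<1-Phat {s} pos (u , w) with thr ≤? ((F s u ⊓ F s w) * (1ℚ - Pval s (u , w)))
  ... | yes thr≤ = *-cancelˡ-pos (⊓-pos (pos u) (pos w)) (<-≤-trans 0<thr thr≤)
  ... | no _     = positive⁻¹ 1ℚ

  step-positiveF : ∀ {s} → PositiveF s → ∀ ex → PositiveF (step s ex)
  step-positiveF pos ((u , w) , x) y with touches? y (u , w)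
  ... | true  = *-pos (pos y) (0<1-Phat pos (u , w))
  ... | false = pos y

  run-positiveF : ∀ {s} → PositiveF s → ∀ exs → PositiveF (run s exs)
  run-positiveF pos []         = pos
  run-positiveF pos (ex ∷ exs) = run-positiveF (step-positiveF pos ex) exs

  initState-positiveF : PositiveF initState
  initState-positiveF _ = positive⁻¹ 1ℚ

  module _ (v : Fin n) where

    charge : State n → Edge n → ℚ
    charge s e with other v e
    ... | nothing = 0ℚ
    ... | just u with covered? (M s) u
    ...   | yes _ = 0ℚ
    ...   | no _  = c * inv (F s u)

    term≡charge : ∀ es X (i : Fin (length es)) →
                  term es X v i ≡ charge (stateBefore es X (toℕ i)) (lookup es i)
    term≡charge es X i with other v (lookup es i)
    ... | nothing = refl
    ... | just u with covered? (M (stateBefore es X (toℕ i))) u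
    ...   | yes _ = refl
    ...   | no _  = refl

    0≤charge : ∀ {s} → PositiveF s → ∀ e → 0ℚ ≤ charge s e
    0≤charge {s} pos e with other v e
    ... | nothing = ≤-refl
    ... | just u with covered? (M s) u
    ...   | yes _ = ≤-refl
    ...   | no _  = 0≤c*inv (pos u)

    F*Pval≤charge : ∀ {s} → PositiveF s → ∀ e → touches? v e ≡ true → F s v * Pval s e ≤ charge s e
    F*Pval≤charge {s} pos (a , b) t with a Finₚ.≟ v | b Finₚ.≟ v
    F*Pval≤charge {s} pos (.v , b) t | yes refl | _ with covered? (M s) v | covered? (M s) b
    ... | no _  | no _  = ≤-reflexive (x*[c*inv[x*y]]≡c*inv[y] c (pos v) (pos b))
    ... | no _  | yes _ = ≤-reflexive (*-zeroʳ (F s v))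
    ... | yes _ | yes _ = ≤-reflexive (*-zeroʳ (F s v))
    ... | yes _ | no _  = ≤-trans (≤-reflexive (*-zeroʳ (F s v))) (0≤c*inv (pos b))
    F*Pval≤charge {s} pos (a , .v) t | no _ | yes refl with covered? (M s) a | covered? (M s) v
    ... | no _  | no _  = ≤-reflexive (trans (cong (λ z → F s v * (c * inv z)) (*-comm (F s a) (F s v)))
                                             (x*[c*inv[x*y]]≡c*inv[y] c (pos v) (pos a)))
    ... | no _  | yes _ = ≤-trans (≤-reflexive (*-zeroʳ (F s v))) (0≤c*inv (pos a))
    ... | yes _ | _     = ≤-reflexive (*-zeroʳ (F s v))
    F*Pval≤charge pos (a , b) () | no _ | no _

    F*Phat≤charge : ∀ {s} → PositiveF s → ∀ e → touches? v e ≡ true → F s v * Phat s e ≤ charge s e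
    F*Phat≤charge {s} pos e t = [ bound-if-0 , bound-if-Pval ]′ (Phat≡0⊎Phat≡Pval s e)
      where
      bound-if-0 : Phat s e ≡ 0ℚ → F s v * Phat s e ≤ charge s e
      bound-if-0 Phat≡0 =
        ≤-trans (≤-reflexive (trans (cong (F s v *_) Phat≡0) (*-zeroʳ (F s v)))) (0≤charge pos e)
      bound-if-Pval : Phat s e ≡ Pval s e → F s v * Phat s e ≤ charge s e
      bound-if-Pval Phat≡Pval = subst (λ p → F s v * p ≤ charge s e) (sym Phat≡Pval) (F*Pval≤charge pos e t)

    F-charge≤F∘step : ∀ {s} → PositiveF s → ∀ e x → F s v - charge s e ≤ F (step s (e , x)) v
    F-charge≤F∘step {s} pos e@(_ , _) x = bound (touches? v e) refl
      where
      bound : ∀ β → touches? v e ≡ β → F s v - charge s e ≤ (if β then F s v * (1ℚ - Phat s e) else F s v)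
      bound true  t = x-y≤x*[1-p] {F s v} (F*Phat≤charge {s} pos e t)
      bound false _ = x-y≤x {F s v} (0≤charge {s} pos e)

    F-charge≤F∘run-take : ∀ {s} → PositiveF s → ∀ es ys (i : Fin (length es)) →
      let sᵢ = run s (take (toℕ i) (zip es ys)) in
      F sᵢ v - charge sᵢ (lookup es i) ≤ F (run s (take (suc (toℕ i)) (zip es ys))) v
    F-charge≤F∘run-take pos (e ∷ es) []       Fin.zero    = x-y≤x (0≤charge pos e)
    F-charge≤F∘run-take pos (e ∷ es) []       (Fin.suc i) = x-y≤x (0≤charge pos (lookup es i))
    F-charge≤F∘run-take pos (e ∷ es) (y ∷ ys) Fin.zero    = F-charge≤F∘step pos e y
    F-charge≤F∘run-take pos (e ∷ es) (y ∷ ys) (Fin.suc i) =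
      F-charge≤F∘run-take (step-positiveF pos (e , y)) es ys i

    1-sumS≤finalF : ∀ es X → 1ℚ - sumS es X v ≤ finalF es X v
    1-sumS≤finalF es X = begin
      1ℚ - sumS es X v          ≡⟨ cong (_-_ 1ℚ) (sumS≡sum Δ q es X v) ⟩
      1ℚ - sum (term es X v)    ≤⟨ a₀-sum≤aₖ Fₜ (term es X v) drop ⟩
      finalF es X v             ∎
      where
      open ≤-Reasoning
      Fₜ : ℕ → ℚ
      Fₜ t = F (stateBefore es X t) v
      drop : ∀ i → Fₜ (toℕ i) - term es X v i ≤ Fₜ (suc (toℕ i))
      -- The `_` is the list of samples built locally inside stateBefore.
      drop i = subst (λ z → Fₜ (toℕ i) - z ≤ Fₜ (suc (toℕ i))) (sym (term≡charge es X i))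
                     (F-charge≤F∘run-take initState-positiveF es _ i)

0≤c : ∀ {Δ q} → 0ℚ < q → 0ℚ < ℕtoℚ Δ → 0ℚ ≤ Algorithm.c Δ q
0≤c 0<q 0<Δ = <⇒≤ (inv-pos (+-mono-< 0<Δ 0<q))

0<thr : ∀ {Δ q} → 0ℚ < q → 0ℚ < ℕtoℚ Δ → 0ℚ < Algorithm.thr Δ q
0<thr {zero}  _   0<0 = contradiction refl (<⇒≢ 0<0)
0<thr {suc d} 0<q _   = *-pos 0<q (inv-pos (ℕtoℚ-pos (4 ℕ.* suc d)))

lemma4p5 : (n Δ : ℕ) (q : ℚ) (es : List (Edge n)) (X : ℕ → ℚ) (v : Fin n) →
    Simple es → MaxDegreeAtMost es Δ →
    0ℚ < q → ℕtoℚ 64 * ℕtoℚ Δ ≤ q * q → ℕtoℚ 4 * q ≤ ℕtoℚ Δ →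
    ((t : ℕ) → (0ℚ ≤ X t) × (X t ≤ 1ℚ)) →
    (1ℚ - Algorithm.sumS Δ q es X v ≤ Algorithm.finalF Δ q es X v)
    × (Algorithm.sumS Δ q es X v ≤ ℕtoℚ Δ * inv (ℕtoℚ Δ + q * inv (ℕtoℚ 2)) →
       q * inv (ℕtoℚ 3 * ℕtoℚ Δ) ≤ Algorithm.finalF Δ q es X v)
lemma4p5 n Δ q es X v _ _ 0<q _ 4q≤Δ _ = 1-sumS≤finalF , λ sumS≤ → begin
  q * inv (ℕtoℚ 3 * ℕtoℚ Δ)                      ≤⟨ q*inv[3D]≤1-D*inv[D+q/2] 0<q q≤Δ ⟩
  1ℚ - ℕtoℚ Δ * inv (ℕtoℚ Δ + q * inv (ℕtoℚ 2))  ≤⟨ +-monoʳ-≤ 1ℚ (neg-antimono-≤ sumS≤) ⟩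
  1ℚ - Algorithm.sumS Δ q es X v                 ≤⟨ 1-sumS≤finalF ⟩
  Algorithm.finalF Δ q es X v                    ∎
  where
  open ≤-Reasoning
  q≤Δ : q ≤ ℕtoℚ Δ
  q≤Δ = ≤-trans (x≤k*x {k = ℕtoℚ 4} (<⇒≤ 0<q) (≤ᵇ⇒≤ _)) 4q≤Δ
  0<Δ : 0ℚ < ℕtoℚ Δ
  0<Δ = <-≤-trans 0<q q≤Δ
  1-sumS≤finalF : 1ℚ - Algorithm.sumS Δ q es X v ≤ Algorithm.finalF Δ q es X v
  1-sumS≤finalF = Bounds.1-sumS≤finalF Δ q (0≤c {Δ} 0<q 0<Δ) (0<thr {Δ} 0<q 0<Δ) v es X
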